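{- Let $R\ge1$ be an integer and let $T\subset\frac1R\mathbb Z$ be a finite set of $N=\#T\ge2$ distinct rational numbers whose denominators divide $R$. Then \[ \frac{1}{N^2-N}\sum_{\substack{s,t\in T\\ s\ne t}}\mathbb B_2(s-t)\ \ge\ \frac{1}{6R^2}-\frac{1}{6(N-1)}. \]
   Context: $\mathbb B_2$ is the second periodic Bernoulli polynomial: $\mathbb B_2(x)=x^2-x+\frac16$ for $0\le x\le1$, extended to $\mathbb R$ with period $1$. -}

module Defs where

open import Data.Nat as ℕ using (ℕ; zero; suc)
open import Data.Integer as ℤ using (ℤ; +_)
open import Data.Rational using (ℚ; _/_; _+_; _-_; _*_; floor; 0ℚ)
open import Data.List using (List; []; _∷_; foldr; map; concatMap)
open import Relation.Nullary using (yes; no)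
open import Data.Rational.Properties using (_≟_)

frac : ℚ → ℚ
frac x = x - (floor x / 1)

B₂ : ℚ → ℚ
B₂ x = frac x * frac x - frac x + (+ 1 / 6)

-- 1/n as a rational, with the (unused) junk value 1/0 := 0
inv : ℕ → ℚ
inv zero = 0ℚ
inv (suc n) = + 1 / suc n

sumℚ : List ℚ → ℚ
sumℚ = foldr _+_ 0ℚ

offDiagSum : List ℚ → ℚ
offDiagSum T = sumℚ (concatMap (λ s → concatMap (λ t → term s t) T) T)
  where
  term : ℚ → ℚ → List ℚ
  term s t with s ≟ t
  ... | yes _ = []
  ... | no _ = B₂ (s - t) ∷ []

-- Write each t ∈ T as q + a/R with q ∈ ℤ and 0 ≤ a < R, and let S_a(b) = 2((b − a) mod R) + 1 − R be the
-- centred sawtooth on ℤ/R.  Splitting the range of b at a and c and summing three quadratics shows that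
-- R·(6R²·B₂(s − t) − 1) = 3·Σ_{b<R} S_a(b)·S_c(b) for grid points s, t with residues a, c: both sides equal
-- R·(6v² − 6Rv + R² − 1) with v = (a − c) mod R.  Summing over s, t ∈ T turns the full energy
-- E = Σ_{s,t} B₂(s − t) into R·(6R²·E − N²) = 3·Σ_b (Σ_s S_{a_s}(b))² ≥ 0.  The diagonal contributes
-- N·B₂(0) = N/6, so the off-diagonal sum is at least N²/(6R²) − N/6, and dividing by N(N − 1) gives the
-- bound since N/(N − 1) ≥ 1.
{-# OPTIONS --safe #-}
module Submission where

open import Defs
open import Data.Nat as ℕ using (ℕ; zero; suc; _∸_)
import Data.Nat.Properties as ℕ
import Data.Nat.Literals as ℕ-literals
open import Data.Nat.Coprimality using (1-coprimeTo)
import Data.Nat.Coprimality as Coprime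
open import Data.Integer as ℤ using (ℤ; +_; -[1+_])
import Data.Integer.Properties as ℤ
open import Data.Integer.DivMod using (a≡a%n+[a/n]*n; n%d<d)
open import Data.Rational
open import Data.Rational.Properties
open import Data.Rational.Literals using (number)
open import Agda.Builtin.FromNat using (Number; fromNat)
open import Data.Unit using (tt)
open import Data.Bool using (if_then_else_)
open import Data.Product using (∃; _,_; proj₁; proj₂)
open import Data.Sum using (inj₁; inj₂)
open import Data.List using (List; []; _∷_; _++_; concatMap; length; upTo)
open import Data.List.Properties using (upTo-∷ʳ)
open import Data.List.Membership.Propositional using (_∈_)
open import Data.List.Relation.Unary.All as All using (All; []; _∷_)
open import Data.List.Relation.Unary.All.Properties using (all-upTo)
open import Data.List.Relation.Unary.Any using (here; there)
open import Data.List.Relation.Unary.Unique.Propositional using (Unique; _∷_)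
open import Relation.Nullary using (yes; no; does)
open import Relation.Nullary.Decidable using (dec⇒maybe; dec-true; dec-false)
open import Relation.Binary.PropositionalEquality
open import Tactic.RingSolver using (solve-∀)
open import Tactic.RingSolver.Core.AlmostCommutativeRing using (AlmostCommutativeRing; fromCommutativeRing)

-- With FromNat loaded every numeral is overloaded, the ℕ ones included.
instance
  ℚ-number : Number ℚ
  ℚ-number = number
  ℕ-number : Number ℕ
  ℕ-number = ℕ-literals.number

ℚ-ring : AlmostCommutativeRing _ _
ℚ-ring = fromCommutativeRing +-*-commutativeRing (λ x → dec⇒maybe (0 ≟ x))

fromℤ : ℤ → ℚ
fromℤ z = z / 1

ι : ℕ → ℚ
ι n = fromℤ (+ n)

fromℤ≡mkℚ : ∀ z → fromℤ z ≡ mkℚ z 0 (Coprime.sym (1-coprimeTo ℤ.∣ z ∣))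
fromℤ≡mkℚ (+ n) = normalize-coprime (Coprime.sym (1-coprimeTo n))
fromℤ≡mkℚ -[1+ n ] = cong -_ (normalize-coprime (Coprime.sym (1-coprimeTo (suc n))))

fromℤ-+ : ∀ a b → fromℤ (a ℤ.+ b) ≡ fromℤ a + fromℤ b
fromℤ-+ a b rewrite fromℤ≡mkℚ a | fromℤ≡mkℚ b =
  cong (_/ 1) (cong₂ ℤ._+_ (sym (ℤ.*-identityʳ a)) (sym (ℤ.*-identityʳ b)))

fromℤ-* : ∀ a b → fromℤ (a ℤ.* b) ≡ fromℤ a * fromℤ b
fromℤ-* a b rewrite fromℤ≡mkℚ a | fromℤ≡mkℚ b = refl

fromℤ-neg : ∀ a → fromℤ (ℤ.- a) ≡ - fromℤ a
fromℤ-neg (+ zero) = refl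
fromℤ-neg (+ suc n) rewrite fromℤ≡mkℚ (+ suc n) = refl
fromℤ-neg -[1+ n ] rewrite fromℤ≡mkℚ (+ suc n) = refl

fromℤ-- : ∀ a b → fromℤ (a ℤ.- b) ≡ fromℤ a - fromℤ b
fromℤ-- a b = trans (fromℤ-+ a (ℤ.- b)) (cong (λ x → fromℤ a + x) (fromℤ-neg b))

fromℤ-mono-< : ∀ {a b} → a ℤ.< b → fromℤ a < fromℤ b
fromℤ-mono-< {a} {b} a<b rewrite fromℤ≡mkℚ a | fromℤ≡mkℚ b =
  *<* (subst₂ ℤ._<_ (sym (ℤ.*-identityʳ a)) (sym (ℤ.*-identityʳ b)) a<b)

fromℤ-cancel-< : ∀ {a b} → fromℤ a < fromℤ b → a ℤ.< b
fromℤ-cancel-< {a} {b} a<b rewrite fromℤ≡mkℚ a | fromℤ≡mkℚ b =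
  subst₂ ℤ._<_ (ℤ.*-identityʳ a) (ℤ.*-identityʳ b) (drop-*<* a<b)

ι-+ : ∀ m n → ι (m ℕ.+ n) ≡ ι m + ι n
ι-+ m n = fromℤ-+ (+ m) (+ n)

ι-* : ∀ m n → ι (m ℕ.* n) ≡ ι m * ι n
ι-* m n = trans (cong fromℤ (ℤ.pos-* m n)) (fromℤ-* (+ m) (+ n))

ι-suc : ∀ n → ι (suc n) ≡ 1 + ι n
ι-suc = ι-+ 1

ι-nonNeg : ∀ n → 0 ≤ ι n
ι-nonNeg n = nonNegative⁻¹ (ι n) {{normalize-nonNeg n 1}}

ι-mono-< : ∀ {m n} → m ℕ.< n → ι m < ι n
ι-mono-< m<n = fromℤ-mono-< (ℤ.+<+ m<n)

ι*inv : ∀ n .{{_ : ℕ.NonZero n}} → ι n * inv n ≡ 1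
ι*inv (suc n) rewrite fromℤ≡mkℚ (+ suc n) | normalize-coprime (1-coprimeTo (suc n)) =
  *-inverseʳ (mkℚ (+ suc n) 0 (Coprime.sym (1-coprimeTo (suc n))))

inv-nonNeg : ∀ n → 0 ≤ inv n
inv-nonNeg zero = ≤-refl
inv-nonNeg (suc n) = nonNegative⁻¹ (inv (suc n)) {{normalize-nonNeg 1 (suc n)}}

inv-pos : ∀ n .{{_ : ℕ.NonZero n}} → 0 < inv n
inv-pos (suc n) = positive⁻¹ (inv (suc n)) {{normalize-pos 1 (suc n) {{_}} {{_}}}}

-- Lets solve-∀ use a hypothesis e ≡ 1: prove the goal up to a term (e − 1)·X, then drop it.
cancel-unit : ∀ {e} A X → e ≡ 1 → A + (e - 1) * X ≡ A
cancel-unit A X refl = trans (cong (λ y → A + y) (*-zeroˡ X)) (+-identityʳ A)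

0≤q-p⇒p≤q : ∀ {p q} → 0 ≤ q - p → p ≤ q
0≤q-p⇒p≤q {p} {q} 0≤q-p = subst₂ _≤_ (+-identityʳ p) (p+[q-p]≡q p q) (+-monoʳ-≤ p 0≤q-p)
  where
  p+[q-p]≡q : ∀ p q → p + (q - p) ≡ q
  p+[q-p]≡q = solve-∀ ℚ-ring

p≤q⇒0≤q-p : ∀ {p q} → p ≤ q → 0 ≤ q - p
p≤q⇒0≤q-p {p} {q} p≤q = subst (_≤ q - p) (+-inverseʳ p) (+-monoˡ-≤ (- p) p≤q)

*-nonNeg : ∀ {p q} → 0 ≤ p → 0 ≤ q → 0 ≤ p * q
*-nonNeg {p} {q} p≥0 q≥0 = nonNegative⁻¹ (p * q) {{nonNeg*nonNeg⇒nonNeg p {{nonNegative p≥0}} q {{nonNegative q≥0}}}}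

square-nonNeg : ∀ p → 0 ≤ p * p
square-nonNeg p with ≤-total 0 p
... | inj₁ p≥0 = *-nonNeg p≥0 p≥0
... | inj₂ p≤0 = nonNegative⁻¹ (p * p) {{nonPos*nonPos⇒nonPos p {{nonPositive p≤0}} p {{nonPositive p≤0}}}}

+-nonNeg : ∀ {p q} → 0 ≤ p → 0 ≤ q → 0 ≤ p + q
+-nonNeg {p} {q} p≥0 q≥0 = subst (_≤ p + q) (+-identityˡ 0) (+-mono-≤ p≥0 q≥0)

floor-≤ : ∀ x → fromℤ (floor x) ≤ x
floor-≤ x@(mkℚ n d _) rewrite fromℤ≡mkℚ (floor x) =
  *≤* (subst₂ ℤ._≤_ refl (sym (ℤ.*-identityʳ n))
    (subst (ℤ._≤_ _) (sym (a≡a%n+[a/n]*n n (+ suc d))) (ℤ.i≤j+i _ (+ (n ℤ.% + suc d)))))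

<-floor+1 : ∀ x → x < fromℤ (ℤ.suc (floor x))
<-floor+1 x@(mkℚ n d _) rewrite fromℤ≡mkℚ (ℤ.suc (floor x)) =
  *<* (subst₂ ℤ._<_ (sym (ℤ.*-identityʳ n)) (sym [q+1]*D)
    (subst (ℤ._< D ℤ.+ q ℤ.* D) (sym (a≡a%n+[a/n]*n n D)) (ℤ.+-monoˡ-< (q ℤ.* D) (ℤ.+<+ (n%d<d n D)))))
  where
  D = + suc d
  q = n ℤ./ D
  [q+1]*D : (+ 1 ℤ.+ q) ℤ.* D ≡ D ℤ.+ q ℤ.* D
  [q+1]*D = trans (ℤ.*-distribʳ-+ D (+ 1) q) (cong (ℤ._+ q ℤ.* D) (ℤ.*-identityˡ D))

<suc⇒≤ : ∀ {a b} → a ℤ.< ℤ.suc b → a ℤ.≤ b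
<suc⇒≤ {b = b} a<b+1 = subst (ℤ._≤_ _) (ℤ.pred-suc b) (ℤ.i<j⇒i≤pred[j] a<b+1)

floor-unique : ∀ {x m} → fromℤ m ≤ x → x < fromℤ (ℤ.suc m) → floor x ≡ m
floor-unique {x} {m} m≤x x<m+1 = ℤ.≤-antisym
  (<suc⇒≤ (fromℤ-cancel-< (≤-<-trans (floor-≤ x) x<m+1)))
  (<suc⇒≤ (fromℤ-cancel-< (≤-<-trans m≤x (<-floor+1 x))))

floor-fromℤ : ∀ k → floor (fromℤ k) ≡ k
floor-fromℤ k = floor-unique {fromℤ k} {k} ≤-refl (fromℤ-mono-< (ℤ.≤∧≢⇒< (ℤ.i≤suc[i] k) ℤ.i≢suc[i]))

frac-fromℤ+ : ∀ m {y} → 0 ≤ y → y < 1 → frac (fromℤ m + y) ≡ y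
frac-fromℤ+ m {y} 0≤y y<1 = begin
    fromℤ m + y - fromℤ (floor (fromℤ m + y))
  ≡⟨ cong (λ k → fromℤ m + y - fromℤ k) (floor-unique {fromℤ m + y} {m} m≤m+y m+y<m+1) ⟩
    fromℤ m + y - fromℤ m
  ≡⟨ add-sub-cancel (fromℤ m) y ⟩
    y ∎
  where
  open ≡-Reasoning
  add-sub-cancel : ∀ a b → a + b - a ≡ b
  add-sub-cancel = solve-∀ ℚ-ring
  m≤m+y : fromℤ m ≤ fromℤ m + y
  m≤m+y = subst (_≤ fromℤ m + y) (+-identityʳ (fromℤ m)) (+-monoʳ-≤ (fromℤ m) 0≤y)
  m+y<m+1 : fromℤ m + y < fromℤ (ℤ.suc m)
  m+y<m+1 = subst (fromℤ m + y <_) (trans (+-comm (fromℤ m) 1) (sym (fromℤ-+ (+ 1) m))) (+-monoʳ-< (fromℤ m) y<1)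

∑ : {A : Set} → List A → (A → ℚ) → ℚ
∑ [] f = 0
∑ (x ∷ xs) f = f x + ∑ xs f

syntax ∑ xs (λ x → e) = ∑[ x ∈ xs ] e

module _ {A : Set} where

  ∑-cong : ∀ {f g : A → ℚ} {xs} → All (λ x → f x ≡ g x) xs → ∑ xs f ≡ ∑ xs g
  ∑-cong [] = refl
  ∑-cong (fx≡gx ∷ eqs) = cong₂ _+_ fx≡gx (∑-cong eqs)

  ∑-++ : ∀ xs ys (f : A → ℚ) → ∑ (xs ++ ys) f ≡ ∑ xs f + ∑ ys f
  ∑-++ [] ys f = sym (+-identityˡ _)
  ∑-++ (x ∷ xs) ys f = trans (cong (_+_ (f x)) (∑-++ xs ys f)) (sym (+-assoc (f x) _ _))

  ∑-+ : ∀ (f g : A → ℚ) xs → ∑[ x ∈ xs ] (f x + g x) ≡ ∑ xs f + ∑ xs g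
  ∑-+ f g [] = refl
  ∑-+ f g (x ∷ xs) = trans (cong (_+_ (f x + g x)) (∑-+ f g xs)) (interchange (f x) (g x) (∑ xs f) (∑ xs g))
    where
    interchange : ∀ a b c d → a + b + (c + d) ≡ a + c + (b + d)
    interchange = solve-∀ ℚ-ring

  ∑-*ˡ : ∀ c (f : A → ℚ) xs → ∑[ x ∈ xs ] (c * f x) ≡ c * ∑ xs f
  ∑-*ˡ c f [] = sym (*-zeroʳ c)
  ∑-*ˡ c f (x ∷ xs) = trans (cong (_+_ (c * f x)) (∑-*ˡ c f xs)) (sym (*-distribˡ-+ c (f x) (∑ xs f)))

  ∑-const : ∀ c (xs : List A) → ∑[ x ∈ xs ] c ≡ c * ι (length xs)
  ∑-const c [] = sym (*-zeroʳ c)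
  ∑-const c (x ∷ xs) = trans (cong (_+_ c) (∑-const c xs)) (trans (c+cn≡c[1+n] c (ι (length xs))) (cong (c *_) (sym (ι-suc (length xs)))))
    where
    c+cn≡c[1+n] : ∀ c n → c + c * n ≡ c * (1 + n)
    c+cn≡c[1+n] = solve-∀ ℚ-ring

  ∑-affine : ∀ c a d (f : A → ℚ) xs → ∑[ x ∈ xs ] (c * (a * f x - d)) ≡ c * (a * ∑ xs f - d * ι (length xs))
  ∑-affine c a d f [] = empty c a d
    where
    empty : ∀ c a d → 0 ≡ c * (a * 0 - d * 0)
    empty = solve-∀ ℚ-ring
  ∑-affine c a d f (x ∷ xs) = begin
      c * (a * f x - d) + ∑[ x ∈ xs ] (c * (a * f x - d))
    ≡⟨ cong (_+_ (c * (a * f x - d))) (∑-affine c a d f xs) ⟩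
      c * (a * f x - d) + c * (a * ∑ xs f - d * ι (length xs))
    ≡⟨ step c a d (f x) (∑ xs f) (ι (length xs)) ⟩
      c * (a * (f x + ∑ xs f) - d * (1 + ι (length xs)))
    ≡⟨ cong (λ n → c * (a * (f x + ∑ xs f) - d * n)) (sym (ι-suc (length xs))) ⟩
      c * (a * (f x + ∑ xs f) - d * ι (suc (length xs)))
    ∎
    where
    open ≡-Reasoning
    step : ∀ c a d y S n → c * (a * y - d) + c * (a * S - d * n) ≡ c * (a * (y + S) - d * (1 + n))
    step = solve-∀ ℚ-ring

  ∑-nonNeg : ∀ {f : A → ℚ} → (∀ x → 0 ≤ f x) → ∀ xs → 0 ≤ ∑ xs f
  ∑-nonNeg f≥0 [] = ≤-refl
  ∑-nonNeg f≥0 (x ∷ xs) = +-nonNeg (f≥0 x) (∑-nonNeg f≥0 xs)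

  ∑-square : ∀ (f : A → ℚ) xs → ∑[ x ∈ xs ] ∑[ y ∈ xs ] (f x * f y) ≡ ∑ xs f * ∑ xs f
  ∑-square f xs = begin
      ∑[ x ∈ xs ] ∑[ y ∈ xs ] (f x * f y)  ≡⟨ ∑-cong (All.universal (λ x → ∑-*ˡ (f x) f xs) xs) ⟩
      ∑[ x ∈ xs ] (f x * ∑ xs f)           ≡⟨ ∑-cong (All.universal (λ x → *-comm (f x) (∑ xs f)) xs) ⟩
      ∑[ x ∈ xs ] (∑ xs f * f x)           ≡⟨ ∑-*ˡ (∑ xs f) f xs ⟩
      ∑ xs f * ∑ xs f                      ∎
    where open ≡-Reasoning

module _ {A B : Set} where

  ∑-comm : ∀ (f : A → B → ℚ) xs ys → ∑[ x ∈ xs ] ∑[ y ∈ ys ] f x y ≡ ∑[ y ∈ ys ] ∑[ x ∈ xs ] f x y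
  ∑-comm f [] ys = sym (trans (∑-const 0 ys) (*-zeroˡ (ι (length ys))))
  ∑-comm f (x ∷ xs) ys = trans (cong (_+_ (∑ ys (f x))) (∑-comm f xs ys)) (sym (∑-+ (f x) (λ y → ∑[ x ∈ xs ] f x y) ys))

  ∑-inner-products : ∀ (f : A → B → ℚ) xs ys →
    ∑[ x ∈ xs ] ∑[ y ∈ xs ] ∑[ b ∈ ys ] (f x b * f y b) ≡ ∑[ b ∈ ys ] (∑[ x ∈ xs ] f x b * ∑[ x ∈ xs ] f x b)
  ∑-inner-products f xs ys = begin
      ∑[ x ∈ xs ] ∑[ y ∈ xs ] ∑[ b ∈ ys ] (f x b * f y b)
    ≡⟨ ∑-cong (All.universal (λ x → ∑-comm (λ y b → f x b * f y b) xs ys) xs) ⟩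
      ∑[ x ∈ xs ] ∑[ b ∈ ys ] ∑[ y ∈ xs ] (f x b * f y b)
    ≡⟨ ∑-comm (λ x b → ∑[ y ∈ xs ] (f x b * f y b)) xs ys ⟩
      ∑[ b ∈ ys ] ∑[ x ∈ xs ] ∑[ y ∈ xs ] (f x b * f y b)
    ≡⟨ ∑-cong (All.universal (λ b → ∑-square (λ x → f x b) xs) ys) ⟩
      ∑[ b ∈ ys ] (∑[ x ∈ xs ] f x b * ∑[ x ∈ xs ] f x b)
    ∎
    where open ≡-Reasoning

∑-upTo-suc : ∀ n (f : ℕ → ℚ) → ∑ (upTo (suc n)) f ≡ ∑ (upTo n) f + f n
∑-upTo-suc n f = trans (cong (λ bs → ∑ bs f) (sym (upTo-∷ʳ n))) (trans (∑-++ (upTo n) (n ∷ []) f) (cong (_+_ (∑ (upTo n) f)) (+-identityʳ (f n))))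

∑-upTo-+ : ∀ m n (f : ℕ → ℚ) → ∑ (upTo (m ℕ.+ n)) f ≡ ∑ (upTo m) f + ∑[ b ∈ upTo n ] f (m ℕ.+ b)
∑-upTo-+ m zero f rewrite ℕ.+-identityʳ m = sym (+-identityʳ _)
∑-upTo-+ m (suc n) f rewrite ℕ.+-suc m n = begin
    ∑ (upTo (suc (m ℕ.+ n))) f
  ≡⟨ ∑-upTo-suc (m ℕ.+ n) f ⟩
    ∑ (upTo (m ℕ.+ n)) f + f (m ℕ.+ n)
  ≡⟨ cong (_+ f (m ℕ.+ n)) (∑-upTo-+ m n f) ⟩
    ∑ (upTo m) f + ∑[ b ∈ upTo n ] f (m ℕ.+ b) + f (m ℕ.+ n)
  ≡⟨ +-assoc (∑ (upTo m) f) _ _ ⟩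
    ∑ (upTo m) f + (∑[ b ∈ upTo n ] f (m ℕ.+ b) + f (m ℕ.+ n))
  ≡⟨ cong (_+_ (∑ (upTo m) f)) (sym (∑-upTo-suc n (λ b → f (m ℕ.+ b)))) ⟩
    ∑ (upTo m) f + ∑[ b ∈ upTo (suc n) ] f (m ℕ.+ b)
  ∎
  where open ≡-Reasoning

sumℚ-concatMap : ∀ {A : Set} (g : A → List ℚ) xs → sumℚ (concatMap g xs) ≡ ∑[ x ∈ xs ] sumℚ (g x)
sumℚ-concatMap g [] = refl
sumℚ-concatMap g (x ∷ xs) = trans (sumℚ-++ (g x) (concatMap g xs)) (cong (_+_ (sumℚ (g x))) (sumℚ-concatMap g xs))
  where
  sumℚ-++ : ∀ as bs → sumℚ (as ++ bs) ≡ sumℚ as + sumℚ bs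
  sumℚ-++ [] bs = sym (+-identityˡ _)
  sumℚ-++ (a ∷ as) bs = trans (cong (_+_ a) (sumℚ-++ as bs)) (sym (+-assoc a _ _))

-- The centred sawtooth and its autocorrelation

-- κ R v = 6R²·B₂(v/R) − 1 for 0 ≤ v < R.
κ : ℚ → ℚ → ℚ
κ R v = 6 * v * v - 6 * R * v + R * R - 1

-- solve-∀ treats defined functions as opaque constants, so such identities restate κ and cubicSum inline.
κ-reflect : ∀ x y → κ (x + y) x ≡ κ (x + y) y
κ-reflect = polynomial
  where
  polynomial : ∀ x y → let κ = λ R v → 6 * v * v - 6 * R * v + R * R - 1 in κ (x + y) x ≡ κ (x + y) y
  polynomial = solve-∀ ℚ-ring

-- sawtooth R x b = 2((b − x) mod R) + 1 − R for b, x < R.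
sawtooth : ℕ → ℕ → ℕ → ℚ
sawtooth R x b = 2 * ι b + (if does (b ℕ.<? x) then 1 + ι R - 2 * ι x else 1 - ι R - 2 * ι x)

sawtooth-< : ∀ R {x b} → b ℕ.< x → sawtooth R x b ≡ 2 * ι b + (1 + ι R - 2 * ι x)
sawtooth-< R {x} {b} b<x rewrite dec-true (b ℕ.<? x) b<x = refl

sawtooth-≥ : ∀ R {x b} → x ℕ.≤ b → sawtooth R x b ≡ 2 * ι b + (1 - ι R - 2 * ι x)
sawtooth-≥ R {x} {b} x≤b rewrite dec-false (b ℕ.<? x) (ℕ.≤⇒≯ x≤b) = refl

cubicSum : ℚ → ℚ → ℚ → ℚ
cubicSum n α β = 2 * n * (n - 1) * (2 * n - 1) + 3 * (α + β) * n * (n - 1) + 3 * α * β * n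

∑-affine-product : ∀ k n α β →
  3 * ∑[ b ∈ upTo n ] ((2 * ι (k ℕ.+ b) + α) * (2 * ι (k ℕ.+ b) + β)) ≡ cubicSum (ι n) (2 * ι k + α) (2 * ι k + β)
∑-affine-product k zero α β = empty (2 * ι k + α) (2 * ι k + β)
  where
  empty : ∀ α β → 3 * 0 ≡ 2 * 0 * (0 - 1) * (2 * 0 - 1) + 3 * (α + β) * 0 * (0 - 1) + 3 * α * β * 0
  empty = solve-∀ ℚ-ring
∑-affine-product k (suc n) α β = begin
    3 * ∑[ b ∈ upTo (suc n) ] f b
  ≡⟨ cong (3 *_) (∑-upTo-suc n f) ⟩
    3 * (∑[ b ∈ upTo n ] f b + f n)
  ≡⟨ *-distribˡ-+ 3 (∑[ b ∈ upTo n ] f b) (f n) ⟩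
    3 * ∑[ b ∈ upTo n ] f b + 3 * f n
  ≡⟨ cong₂ (λ s x → s + 3 * ((2 * x + α) * (2 * x + β))) (∑-affine-product k n α β) (ι-+ k n) ⟩
    cubicSum (ι n) (2 * ι k + α) (2 * ι k + β) + 3 * ((2 * (ι k + ι n) + α) * (2 * (ι k + ι n) + β))
  ≡⟨ step (ι k) (ι n) α β ⟩
    cubicSum (1 + ι n) (2 * ι k + α) (2 * ι k + β)
  ≡⟨ cong (λ m → cubicSum m (2 * ι k + α) (2 * ι k + β)) (sym (ι-suc n)) ⟩
    cubicSum (ι (suc n)) (2 * ι k + α) (2 * ι k + β)
  ∎
  where
  open ≡-Reasoning
  f : ℕ → ℚ
  f b = (2 * ι (k ℕ.+ b) + α) * (2 * ι (k ℕ.+ b) + β)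
  step : ∀ K N α β → let C = λ n α β → 2 * n * (n - 1) * (2 * n - 1) + 3 * (α + β) * n * (n - 1) + 3 * α * β * n in
    C N (2 * K + α) (2 * K + β) + 3 * ((2 * (K + N) + α) * (2 * (K + N) + β)) ≡ C (1 + N) (2 * K + α) (2 * K + β)
  step = solve-∀ ℚ-ring

segment-sums : ∀ U V W {A R} → A ≡ U + V → R ≡ A + W →
  cubicSum U (2 * 0 + (1 + R - 2 * A)) (2 * 0 + (1 + R - 2 * U))
  + cubicSum V (2 * U + (1 + R - 2 * A)) (2 * U + (1 - R - 2 * U))
  + cubicSum W (2 * A + (1 - R - 2 * A)) (2 * A + (1 - R - 2 * U))
  ≡ R * κ R V
segment-sums U V W refl refl = polynomial U V W
  where
  polynomial : ∀ U V W → let A = U + V; R = A + W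
                             C = λ n α β → 2 * n * (n - 1) * (2 * n - 1) + 3 * (α + β) * n * (n - 1) + 3 * α * β * n in
    C U (2 * 0 + (1 + R - 2 * A)) (2 * 0 + (1 + R - 2 * U))
    + C V (2 * U + (1 + R - 2 * A)) (2 * U + (1 - R - 2 * U))
    + C W (2 * A + (1 - R - 2 * A)) (2 * A + (1 - R - 2 * U))
    ≡ R * (6 * V * V - 6 * R * V + R * R - 1)
  polynomial = solve-∀ ℚ-ring

correlation : ℕ → ℕ → ℕ → ℚ
correlation R x y = ∑[ b ∈ upTo R ] (sawtooth R x b * sawtooth R y b)

correlation-comm : ∀ R x y → correlation R x y ≡ correlation R y x
correlation-comm R x y = ∑-cong (All.universal (λ b → *-comm (sawtooth R x b) (sawtooth R y b)) (upTo R))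

correlation-≥ : ∀ u v w → let R = u ℕ.+ v ℕ.+ w in 3 * correlation R (u ℕ.+ v) u ≡ ι R * κ (ι R) (ι v)
correlation-≥ u v w = begin
    3 * ∑ (upTo R) f
  ≡⟨ cong (3 *_) (trans (∑-upTo-+ x w f) (cong (_+ S₃) (∑-upTo-+ u v f))) ⟩
    3 * (S₁ + S₂ + S₃)
  ≡⟨ distrib 3 S₁ S₂ S₃ ⟩
    3 * S₁ + 3 * S₂ + 3 * S₃
  ≡⟨ trans (cong₂ _+_ (cong₂ _+_ first second) third) (segment-sums (ι u) (ι v) (ι w) (ι-+ u v) (ι-+ x w)) ⟩
    ι R * κ (ι R) (ι v)
  ∎
  where
  open ≡-Reasoning
  x = u ℕ.+ v
  R = x ℕ.+ w
  f : ℕ → ℚ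
  f b = sawtooth R x b * sawtooth R u b
  S₁ S₂ S₃ : ℚ
  S₁ = ∑ (upTo u) f
  S₂ = ∑[ b ∈ upTo v ] f (u ℕ.+ b)
  S₃ = ∑[ b ∈ upTo w ] f (x ℕ.+ b)
  distrib : ∀ c a b d → c * (a + b + d) ≡ c * a + c * b + c * d
  distrib = solve-∀ ℚ-ring
  segment : ∀ k n α β → All (λ b → f (k ℕ.+ b) ≡ (2 * ι (k ℕ.+ b) + α) * (2 * ι (k ℕ.+ b) + β)) (upTo n) →
    3 * ∑[ b ∈ upTo n ] f (k ℕ.+ b) ≡ cubicSum (ι n) (2 * ι k + α) (2 * ι k + β)
  segment k n α β pieces = trans (cong (3 *_) (∑-cong pieces)) (∑-affine-product k n α β)
  first = segment 0 u (1 + ι R - 2 * ι x) (1 + ι R - 2 * ι u) (All.map (λ b<u →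
    cong₂ _*_ (sawtooth-< R (ℕ.<-≤-trans b<u (ℕ.m≤m+n u v))) (sawtooth-< R b<u)) (all-upTo u))
  second = segment u v (1 + ι R - 2 * ι x) (1 - ι R - 2 * ι u) (All.map (λ b<v →
    cong₂ _*_ (sawtooth-< R (ℕ.+-monoʳ-< u b<v)) (sawtooth-≥ R (ℕ.m≤m+n u _))) (all-upTo v))
  third = segment x w (1 - ι R - 2 * ι x) (1 - ι R - 2 * ι u) (All.map (λ {b} _ →
    cong₂ _*_ (sawtooth-≥ R (ℕ.m≤m+n x b)) (sawtooth-≥ R (ℕ.≤-trans (ℕ.m≤m+n u v) (ℕ.m≤m+n x b)))) (all-upTo w))

-- B₂ on the grid (1/R)ℤ

B₂-grid : ∀ m {R v i} → ι R * i ≡ 1 → 0 < i → v ℕ.< R → 6 * ι R * ι R * B₂ (fromℤ m + ι v * i) - 1 ≡ κ (ι R) (ι v)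
B₂-grid m {R} {v} {i} Ri≡1 i>0 v<R = begin
    6 * ι R * ι R * B₂ (fromℤ m + ι v * i) - 1
  ≡⟨ cong (λ y → 6 * ι R * ι R * (y * y - y + + 1 / 6) - 1) (frac-fromℤ+ m 0≤vi vi<1) ⟩
    6 * ι R * ι R * (ι v * i * (ι v * i) - ι v * i + + 1 / 6) - 1
  ≡⟨ expand (ι R) (ι v) i ⟩
    κ (ι R) (ι v) + (ι R * i - 1) * (6 * ι v * ι v * (ι R * i + 1) - 6 * ι R * ι v)
  ≡⟨ cancel-unit (κ (ι R) (ι v)) _ Ri≡1 ⟩
    κ (ι R) (ι v)
  ∎
  where
  open ≡-Reasoning
  0≤vi : 0 ≤ ι v * i
  0≤vi = *-nonNeg (ι-nonNeg v) (<⇒≤ i>0)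
  vi<1 : ι v * i < 1
  vi<1 = subst (ι v * i <_) Ri≡1 (*-monoˡ-<-pos i {{positive i>0}} (ι-mono-< v<R))
  expand : ∀ R v i → 6 * R * R * (v * i * (v * i) - v * i + + 1 / 6) - 1
    ≡ (6 * v * v - 6 * R * v + R * R - 1) + (R * i - 1) * (6 * v * v * (R * i + 1) - 6 * R * v)
  expand = solve-∀ ℚ-ring

module _ {i : ℚ} (i>0 : 0 < i) (qs qt : ℤ) where

  grid-pair-≥ : ∀ {R a c} v w → a ≡ c ℕ.+ v → R ≡ a ℕ.+ w → ι R * i ≡ 1 → 0 ℕ.< w →
    ι R * (6 * ι R * ι R * B₂ ((fromℤ qs + ι a * i) - (fromℤ qt + ι c * i)) - 1) ≡ 3 * correlation R a c
  grid-pair-≥ {c = c} v w refl refl Ri≡1 w>0 = begin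
      ι R * (6 * ι R * ι R * B₂ ((fromℤ qs + ι a * i) - (fromℤ qt + ι c * i)) - 1)
    ≡⟨ cong (λ x → ι R * (6 * ι R * ι R * B₂ x - 1)) difference ⟩
      ι R * (6 * ι R * ι R * B₂ (fromℤ (qs ℤ.- qt) + ι v * i) - 1)
    ≡⟨ cong (ι R *_) (B₂-grid (qs ℤ.- qt) Ri≡1 i>0 v<R) ⟩
      ι R * κ (ι R) (ι v)
    ≡⟨ sym (correlation-≥ c v w) ⟩
      3 * correlation R a c
    ∎
    where
    open ≡-Reasoning
    a = c ℕ.+ v
    R = a ℕ.+ w
    v<R : v ℕ.< R
    v<R = ℕ.≤-<-trans (ℕ.m≤n+m v c) (ℕ.m<m+n a w>0)
    shift : ∀ Qs Qt C V I → Qs + (C + V) * I - (Qt + C * I) ≡ Qs - Qt + V * I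
    shift = solve-∀ ℚ-ring
    difference : (fromℤ qs + ι a * i) - (fromℤ qt + ι c * i) ≡ fromℤ (qs ℤ.- qt) + ι v * i
    difference = begin
        fromℤ qs + ι a * i - (fromℤ qt + ι c * i)
      ≡⟨ cong (λ x → fromℤ qs + x * i - (fromℤ qt + ι c * i)) (ι-+ c v) ⟩
        fromℤ qs + (ι c + ι v) * i - (fromℤ qt + ι c * i)
      ≡⟨ shift (fromℤ qs) (fromℤ qt) (ι c) (ι v) i ⟩
        fromℤ qs - fromℤ qt + ι v * i
      ≡⟨ cong (_+ ι v * i) (sym (fromℤ-- qs qt)) ⟩
        fromℤ (qs ℤ.- qt) + ι v * i
      ∎

  -- Here s − t has integer part qs − qt − 1 and fractional part (R − v)/R, and κ R is symmetric under v ↦ R − v.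
  grid-pair-< : ∀ {R a c} v w → c ≡ a ℕ.+ v → R ≡ c ℕ.+ w → ι R * i ≡ 1 → 0 ℕ.< v →
    ι R * (6 * ι R * ι R * B₂ ((fromℤ qs + ι a * i) - (fromℤ qt + ι c * i)) - 1) ≡ 3 * correlation R a c
  grid-pair-< {a = a} v w refl refl Ri≡1 v>0 = begin
      ι R * (6 * ι R * ι R * B₂ ((fromℤ qs + ι a * i) - (fromℤ qt + ι c * i)) - 1)
    ≡⟨ cong (λ x → ι R * (6 * ι R * ι R * B₂ x - 1)) difference ⟩
      ι R * (6 * ι R * ι R * B₂ (fromℤ (qs ℤ.- qt ℤ.- + 1) + ι (a ℕ.+ w) * i) - 1)
    ≡⟨ cong (ι R *_) (B₂-grid (qs ℤ.- qt ℤ.- + 1) Ri≡1 i>0 a+w<R) ⟩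
      ι R * κ (ι R) (ι (a ℕ.+ w))
    ≡⟨ cong (ι R *_) reflected ⟩
      ι R * κ (ι R) (ι v)
    ≡⟨ sym (correlation-≥ a v w) ⟩
      3 * correlation R c a
    ≡⟨ cong (3 *_) (correlation-comm R c a) ⟩
      3 * correlation R a c
    ∎
    where
    open ≡-Reasoning
    c = a ℕ.+ v
    R = c ℕ.+ w
    a+w<R : a ℕ.+ w ℕ.< R
    a+w<R = ℕ.+-monoˡ-< w (ℕ.m<m+n a v>0)
    ι-R : ι R ≡ ι a + ι v + ι w
    ι-R = trans (ι-+ c w) (cong (_+ ι w) (ι-+ a v))
    swap : ∀ A V W → A + V + W ≡ A + W + V
    swap = solve-∀ ℚ-ring
    reflected : κ (ι R) (ι (a ℕ.+ w)) ≡ κ (ι R) (ι v)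
    reflected = subst (λ r → κ r (ι (a ℕ.+ w)) ≡ κ r (ι v)) (sym R≡) (κ-reflect (ι (a ℕ.+ w)) (ι v))
      where
      R≡ : ι R ≡ ι (a ℕ.+ w) + ι v
      R≡ = trans ι-R (trans (swap (ι a) (ι v) (ι w)) (cong (_+ ι v) (sym (ι-+ a w))))
    shift : ∀ Qs Qt A V W I → Qs + A * I - (Qt + (A + V) * I) ≡ Qs - Qt - 1 + (A + W) * I + ((A + V + W) * I - 1) * (- 1)
    shift = solve-∀ ℚ-ring
    difference : (fromℤ qs + ι a * i) - (fromℤ qt + ι c * i) ≡ fromℤ (qs ℤ.- qt ℤ.- + 1) + ι (a ℕ.+ w) * i
    difference = begin
        fromℤ qs + ι a * i - (fromℤ qt + ι c * i)
      ≡⟨ cong (λ x → fromℤ qs + ι a * i - (fromℤ qt + x * i)) (ι-+ a v) ⟩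
        fromℤ qs + ι a * i - (fromℤ qt + (ι a + ι v) * i)
      ≡⟨ shift (fromℤ qs) (fromℤ qt) (ι a) (ι v) (ι w) i ⟩
        fromℤ qs - fromℤ qt - 1 + (ι a + ι w) * i + ((ι a + ι v + ι w) * i - 1) * (- 1)
      ≡⟨ cancel-unit _ (- 1) (subst (λ r → r * i ≡ 1) ι-R Ri≡1) ⟩
        fromℤ qs - fromℤ qt - 1 + (ι a + ι w) * i
      ≡⟨ cong₂ (λ q x → q + x * i) (sym (trans (fromℤ-- (qs ℤ.- qt) (+ 1)) (cong (_- 1) (fromℤ-- qs qt)))) (sym (ι-+ a w)) ⟩
        fromℤ (qs ℤ.- qt ℤ.- + 1) + ι (a ℕ.+ w) * i
      ∎

  grid-pair : ∀ {R a c} → ι R * i ≡ 1 → a ℕ.< R → c ℕ.< R →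
    ι R * (6 * ι R * ι R * B₂ ((fromℤ qs + ι a * i) - (fromℤ qt + ι c * i)) - 1) ≡ 3 * correlation R a c
  grid-pair {R} {a} {c} Ri≡1 a<R c<R with c ℕ.≤? a
  ... | yes c≤a = grid-pair-≥ (a ∸ c) (R ∸ a) (sym (ℕ.m+[n∸m]≡n c≤a)) (sym (ℕ.m+[n∸m]≡n (ℕ.<⇒≤ a<R))) Ri≡1 (ℕ.m<n⇒0<n∸m a<R)
  ... | no c≰a = grid-pair-< (c ∸ a) (R ∸ c) (sym (ℕ.m+[n∸m]≡n (ℕ.<⇒≤ a<c))) (sym (ℕ.m+[n∸m]≡n (ℕ.<⇒≤ c<R))) Ri≡1 (ℕ.m<n⇒0<n∸m a<c)
    where a<c = ℕ.≰⇒> c≰a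

module Grid (R : ℕ) .{{_ : ℕ.NonZero R}} where

  quotient : ℚ → ℤ
  quotient t = floor (t * ι R) ℤ./ + R

  residue : ℚ → ℕ
  residue t = floor (t * ι R) ℤ.% + R

  residue<R : ∀ t → residue t ℕ.< R
  residue<R t = n%d<d (floor (t * ι R)) (+ R)

  grid-decomposition : ∀ {i t k} → ι R * i ≡ 1 → t * ι R ≡ fromℤ k → t ≡ fromℤ (quotient t) + ι (residue t) * i
  grid-decomposition {i} {t} {k} Ri≡1 tR≡k = begin
      t
    ≡⟨ unscale t (ι R) i ⟩
      t * ι R * i + (ι R * i - 1) * (- t)
    ≡⟨ cancel-unit (t * ι R * i) (- t) Ri≡1 ⟩
      t * ι R * i
    ≡⟨ cong (_* i) tR≡k ⟩
      fromℤ k * i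
    ≡⟨ cong (λ m → fromℤ m * i) (a≡a%n+[a/n]*n k (+ R)) ⟩
      fromℤ (+ r ℤ.+ q ℤ.* + R) * i
    ≡⟨ cong (_* i) (trans (fromℤ-+ (+ r) (q ℤ.* + R)) (cong (λ x → ι r + x) (fromℤ-* q (+ R)))) ⟩
      (ι r + fromℤ q * ι R) * i
    ≡⟨ expand (ι r) (fromℤ q) (ι R) i ⟩
      fromℤ q + ι r * i + (ι R * i - 1) * fromℤ q
    ≡⟨ cancel-unit (fromℤ q + ι r * i) (fromℤ q) Ri≡1 ⟩
      fromℤ q + ι r * i
    ≡⟨ cong (λ m → fromℤ (m ℤ./ + R) + ι (m ℤ.% + R) * i) (sym (trans (cong floor tR≡k) (floor-fromℤ k))) ⟩
      fromℤ (quotient t) + ι (residue t) * i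
    ∎
    where
    open ≡-Reasoning
    q = k ℤ./ + R
    r = k ℤ.% + R
    unscale : ∀ t R i → t ≡ t * R * i + (R * i - 1) * (- t)
    unscale = solve-∀ ℚ-ring
    expand : ∀ r q R i → (r + q * R) * i ≡ q + r * i + (R * i - 1) * q
    expand = solve-∀ ℚ-ring

-- The energy of T

energy : List ℚ → ℚ
energy T = ∑[ s ∈ T ] ∑[ t ∈ T ] B₂ (s - t)

module _ (R : ℕ) .{{_ : ℕ.NonZero R}} {i : ℚ} (Ri≡1 : ι R * i ≡ 1) (i>0 : 0 < i) where
  open Grid R

  energy-bound : ∀ T → All (λ t → ∃ λ k → t * ι R ≡ fromℤ k) T →
    ι (length T) * ι (length T) ≤ 6 * ι R * ι R * energy T
  energy-bound T on-grid = 0≤q-p⇒p≤q (*-cancelˡ-≤-pos (ι R) {{positive R>0}} (subst₂ _≤_ (sym (*-zeroʳ (ι R))) (sym scaled) sum-of-squares≥0))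
    where
    N = ι (length T)
    column : ℕ → ℚ
    column b = ∑[ s ∈ T ] sawtooth R (residue s) b
    R>0 : 0 < ι R
    R>0 = ι-mono-< (ℕ.>-nonZero⁻¹ R)
    sum-of-squares≥0 : 0 ≤ 3 * ∑[ b ∈ upTo R ] (column b * column b)
    sum-of-squares≥0 = *-nonNeg (ι-nonNeg 3) (∑-nonNeg (λ b → square-nonNeg (column b)) (upTo R))
    decomposed : All (λ t → t ≡ fromℤ (quotient t) + ι (residue t) * i) T
    decomposed = All.map (λ (k , tR≡k) → grid-decomposition {k = k} Ri≡1 tR≡k) on-grid
    pair : ∀ {s t} → s ≡ fromℤ (quotient s) + ι (residue s) * i → t ≡ fromℤ (quotient t) + ι (residue t) * i →
      ι R * (6 * ι R * ι R * B₂ (s - t) - 1) ≡ 3 * correlation R (residue s) (residue t)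
    pair {s} {t} s≡ t≡ = trans (cong (λ x → ι R * (6 * ι R * ι R * B₂ x - 1)) (cong₂ _-_ s≡ t≡))
      (grid-pair i>0 (quotient s) (quotient t) Ri≡1 (residue<R s) (residue<R t))
    row : ∀ {s} → s ≡ fromℤ (quotient s) + ι (residue s) * i →
      ι R * (6 * ι R * ι R * ∑[ t ∈ T ] B₂ (s - t) - N) ≡ ∑[ t ∈ T ] (3 * correlation R (residue s) (residue t))
    row {s} s≡ = begin
        ι R * (6 * ι R * ι R * ∑[ t ∈ T ] B₂ (s - t) - N)
      ≡⟨ cong (λ d → ι R * (6 * ι R * ι R * ∑[ t ∈ T ] B₂ (s - t) - d)) (sym (*-identityˡ N)) ⟩
        ι R * (6 * ι R * ι R * ∑[ t ∈ T ] B₂ (s - t) - 1 * N)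
      ≡⟨ sym (∑-affine (ι R) (6 * ι R * ι R) 1 (λ t → B₂ (s - t)) T) ⟩
        ∑[ t ∈ T ] (ι R * (6 * ι R * ι R * B₂ (s - t) - 1))
      ≡⟨ ∑-cong (All.map (pair s≡) decomposed) ⟩
        ∑[ t ∈ T ] (3 * correlation R (residue s) (residue t))
      ∎
      where open ≡-Reasoning
    scaled : ι R * (6 * ι R * ι R * energy T - N * N) ≡ 3 * ∑[ b ∈ upTo R ] (column b * column b)
    scaled = begin
        ι R * (6 * ι R * ι R * energy T - N * N)
      ≡⟨ sym (∑-affine (ι R) (6 * ι R * ι R) N (λ s → ∑[ t ∈ T ] B₂ (s - t)) T) ⟩
        ∑[ s ∈ T ] (ι R * (6 * ι R * ι R * ∑[ t ∈ T ] B₂ (s - t) - N))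
      ≡⟨ ∑-cong (All.map row decomposed) ⟩
        ∑[ s ∈ T ] ∑[ t ∈ T ] (3 * correlation R (residue s) (residue t))
      ≡⟨ trans (∑-cong (All.universal (λ s → ∑-*ˡ 3 (λ t → correlation R (residue s) (residue t)) T) T)) (∑-*ˡ 3 _ T) ⟩
        3 * ∑[ s ∈ T ] ∑[ t ∈ T ] correlation R (residue s) (residue t)
      ≡⟨ cong (3 *_) (∑-inner-products (λ s b → sawtooth R (residue s) b) T (upTo R)) ⟩
        3 * ∑[ b ∈ upTo R ] (column b * column b)
      ∎
      where open ≡-Reasoning

δ : ℚ → ℚ → ℚ
δ s t = if does (s ≟ t) then 1 else 0

δ-refl : ∀ s → δ s s ≡ 1
δ-refl s rewrite dec-true (s ≟ s) refl = refl

δ-≢ : ∀ {s t} → s ≢ t → δ s t ≡ 0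
δ-≢ {s} {t} s≢t rewrite dec-false (s ≟ t) s≢t = refl

∑-δ-∉ : ∀ {s xs} → All (s ≢_) xs → ∑ xs (δ s) ≡ 0
∑-δ-∉ [] = refl
∑-δ-∉ (s≢x ∷ s∉xs) = cong₂ _+_ (δ-≢ s≢x) (∑-δ-∉ s∉xs)

∑-δ-∈ : ∀ {s xs} → Unique xs → s ∈ xs → ∑ xs (δ s) ≡ 1
∑-δ-∈ {s} (s∉xs ∷ _) (here refl) = cong₂ _+_ (δ-refl s) (∑-δ-∉ s∉xs)
∑-δ-∈ {s} {x ∷ _} (x∉xs ∷ unique) (there s∈xs) = cong₂ _+_ (δ-≢ {s} {x} (≢-sym (All.lookup x∉xs s∈xs))) (∑-δ-∈ unique s∈xs)

-- The summand of offDiagSum is local to its where block; unification names it here.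
offDiagSum-unfold : ∀ T → ∃ λ (term : ℚ → ℚ → List ℚ) → offDiagSum T ≡ sumℚ (concatMap (λ s → concatMap (term s) T) T)
offDiagSum-unfold T = _ , refl

sumℚ-summand : ∀ T s t → sumℚ (proj₁ (offDiagSum-unfold T) s t) ≡ B₂ (s - t) + - (+ 1 / 6) * δ s t
sumℚ-summand T s t with s ≟ t
... | yes refl rewrite +-inverseʳ s = refl
... | no _ = refl

offDiagSum-energy : ∀ T → Unique T → offDiagSum T ≡ energy T - ι (length T) * (+ 1 / 6)
offDiagSum-energy T unique = begin
    offDiagSum T
  ≡⟨ proj₂ (offDiagSum-unfold T) ⟩
    sumℚ (concatMap (λ s → concatMap (term s) T) T)
  ≡⟨ trans (sumℚ-concatMap _ T) (∑-cong (All.universal (λ s → sumℚ-concatMap (term s) T) T)) ⟩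
    ∑[ s ∈ T ] ∑[ t ∈ T ] sumℚ (term s t)
  ≡⟨ ∑-cong (All.universal (λ s → ∑-cong (All.universal (sumℚ-summand T s) T)) T) ⟩
    ∑[ s ∈ T ] ∑[ t ∈ T ] (B₂ (s - t) + c * δ s t)
  ≡⟨ ∑-cong (All.tabulate (λ {s} s∈T → trans (∑-+ (λ t → B₂ (s - t)) (λ t → c * δ s t) T)
       (cong (λ x → (∑[ t ∈ T ] B₂ (s - t)) + x) (trans (∑-*ˡ c (δ s) T) (cong (c *_) (∑-δ-∈ unique s∈T)))))) ⟩
    ∑[ s ∈ T ] ((∑[ t ∈ T ] B₂ (s - t)) + c * 1)
  ≡⟨ trans (∑-+ (λ s → ∑[ t ∈ T ] B₂ (s - t)) (λ _ → c * 1) T) (cong (λ x → energy T + x) (∑-const (c * 1) T)) ⟩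
    energy T + c * 1 * ι (length T)
  ≡⟨ tidy (energy T) (ι (length T)) ⟩
    energy T - ι (length T) * (+ 1 / 6)
  ∎
  where
  open ≡-Reasoning
  term = proj₁ (offDiagSum-unfold T)
  c = - (+ 1 / 6)
  tidy : ∀ E N → E + - (+ 1 / 6) * 1 * N ≡ E - N * (+ 1 / 6)
  tidy = solve-∀ ℚ-ring

-- Averaging over the off-diagonal pairs

averaged-bound : ∀ {ρ m N E p q r} → N ≡ 1 + m → ρ * p ≡ 1 → 6 * m * q ≡ 1 → m * N * r ≡ 1 → 0 ≤ m → 0 ≤ p → 0 ≤ r →
  N * N ≤ ρ * E → p - q ≤ r * (E - N * (+ 1 / 6))
averaged-bound {ρ} {m} {_} {E} {p} {q} {r} refl ρp≡1 6mq≡1 mNr≡1 m≥0 p≥0 r≥0 N²≤ρE = 0≤q-p⇒p≤q (subst (0 ≤_) (sym difference) gap≥0)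
  where
  gap≥0 : 0 ≤ r * p * (ρ * E - (1 + m) * (1 + m) + (1 + m))
  gap≥0 = *-nonNeg (*-nonNeg r≥0 p≥0) (+-nonNeg (p≤q⇒0≤q-p N²≤ρE) (+-nonNeg (ι-nonNeg 1) m≥0))
  identity : ∀ ρ m E p q r → r * (E - (1 + m) * (+ 1 / 6)) - (p - q)
    ≡ r * p * (ρ * E - (1 + m) * (1 + m) + (1 + m)) + (6 * m * q - 1) * (r * (1 + m) * (+ 1 / 6))
      + (m * (1 + m) * r - 1) * (p - q) + (ρ * p - 1) * (- (r * E))
  identity = solve-∀ ℚ-ring
  difference : r * (E - (1 + m) * (+ 1 / 6)) - (p - q) ≡ r * p * (ρ * E - (1 + m) * (1 + m) + (1 + m))
  difference = trans (identity ρ m E p q r)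
    (trans (cancel-unit _ _ ρp≡1) (trans (cancel-unit _ _ mNr≡1) (cancel-unit _ _ 6mq≡1)))

averaged-bound-ℕ : ∀ R N {E O} → 1 ℕ.≤ R → 2 ℕ.≤ N → O ≡ E - ι N * (+ 1 / 6) → ι N * ι N ≤ 6 * ι R * ι R * E →
  inv (6 ℕ.* R ℕ.* R) - inv (6 ℕ.* (N ∸ 1)) ≤ inv (N ℕ.* N ∸ N) * O
averaged-bound-ℕ R@(suc _) N@(suc (suc k)) {E} (ℕ.s≤s _) (ℕ.s≤s (ℕ.s≤s _)) refl =
  averaged-bound {6 * ι R * ι R} {ι M} {ι N} {E} (ι-suc M) ρp≡1 6mq≡1 mNr≡1 (ι-nonNeg M) (inv-nonNeg (6 ℕ.* R ℕ.* R)) (inv-nonNeg (N ℕ.* N ∸ N))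
  where
  M = suc k
  ρp≡1 : 6 * ι R * ι R * inv (6 ℕ.* R ℕ.* R) ≡ 1
  ρp≡1 = subst (λ x → x * inv (6 ℕ.* R ℕ.* R) ≡ 1) (trans (ι-* (6 ℕ.* R) R) (cong (_* ι R) (ι-* 6 R))) (ι*inv (6 ℕ.* R ℕ.* R))
  6mq≡1 : 6 * ι M * inv (6 ℕ.* M) ≡ 1
  6mq≡1 = subst (λ x → x * inv (6 ℕ.* M) ≡ 1) (ι-* 6 M) (ι*inv (6 ℕ.* M))
  mNr≡1 : ι M * ι N * inv (N ℕ.* N ∸ N) ≡ 1
  mNr≡1 = subst₂ (λ x n → x * inv n ≡ 1) (ι-* M N) (sym (ℕ.m+n∸m≡n N (M ℕ.* N))) (ι*inv (M ℕ.* N))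

lemma6p4 : (R : ℕ) → 1 ℕ.≤ R → (T : List ℚ) → Unique T →
    All (λ t → ∃ λ (k : ℤ) → t * (+ R / 1) ≡ k / 1) T →
    2 ℕ.≤ length T →
    inv (6 ℕ.* R ℕ.* R) - inv (6 ℕ.* (length T ∸ 1))
      ≤ inv (length T ℕ.* length T ∸ length T) * offDiagSum T
lemma6p4 R 1≤R T unique on-grid 2≤N =
  averaged-bound-ℕ R (length T) 1≤R 2≤N (offDiagSum-energy T unique) (energy-bound R (ι*inv R) (inv-pos R) T on-grid)
  where
  instance
    R≢0 : ℕ.NonZero R
    R≢0 = ℕ.>-nonZero 1≤R
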